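{- Let $T=(V,E)$ be a tree, let $x$ be a centroid vertex of $T$, let $b$ be a leaf of $T$ and let $\bar b$ be the vertex adjacent to $b$. Let $\overline{T}=(V,(E\setminus\{(\bar b,b)\})\cup\{(x,b)\})$ be the tree obtained from $T$ by removing the edge $(\bar b,b)$ and inserting the edge $(x,b)$ instead. Then $x$ is a centroid vertex of $\overline{T}$.
   Context: All graphs are finite, simple, undirected and connected. For a tree $T$ and a vertex $x$, a branch at $x$ is a maximal subtree of $T$ which contains $x$ as a leaf; the weight of a branch is its number of vertices minus one (i.e., excluding $x$). The branch weight $W_T(x)$ of $x$ is the maximum weight of a branch at $x$. A centroid vertex of $T$ is a vertex of minimum branch weight. A leaf is a vertex of degree $1$. -}

module Defs where

open import Data.Nat using (ℕ; zero; suc; _≤_)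
open import Data.Bool using (Bool; true; false; _∧_; _∨_; not)
open import Data.Fin using (Fin; zero; suc; inject₁; fromℕ; _≟_)
open import Data.Fin.Subset using (Subset; _∈_; ∣_∣)
open import Data.List using (List; length; filterᵇ; allFin)
open import Data.Product using (Σ; ∃; _×_; _,_)
open import Data.Sum using (_⊎_)
open import Data.Empty using (⊥)
open import Relation.Binary.PropositionalEquality using (_≡_; _≢_)
open import Relation.Nullary.Decidable using (⌊_⌋)
open import Function.Definitions using (Injective)
open import Function.Bundles using (_⇔_)

Graph : ℕ → Set
Graph n = Fin n → Fin n → Bool

module _ {n : ℕ} (G : Graph n) where

  Adj : Fin n → Fin n → Set
  Adj u v = G u v ≡ true

  IsSimple : Set
  IsSimple = (∀ u v → G u v ≡ G v u) × (∀ u → G u u ≡ false)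

  data Walk : Fin n → Fin n → Set where
    here : ∀ {u} → Walk u u
    step : ∀ {u v w} → Adj u v → Walk v w → Walk u w

  Connected : Set
  Connected = ∀ u v → Walk u v

  Cycle : Set
  Cycle = Σ ℕ λ k → Σ (Fin (suc (suc (suc k))) → Fin n) λ c →
            Injective _≡_ _≡_ c
          × (∀ (i : Fin (suc (suc k))) → Adj (c (inject₁ i)) (c (suc i)))
          × Adj (c (fromℕ (suc (suc k)))) (c zero)

  Acyclic : Set
  Acyclic = Cycle → ⊥

  IsTree : Set
  IsTree = IsSimple × Connected × Acyclic

  degree : Fin n → ℕ
  degree v = length (filterᵇ (G v) (allFin n))

  IsLeaf : Fin n → Set
  IsLeaf v = degree v ≡ 1

  data WalkAvoiding (x : Fin n) : Fin n → Fin n → Set where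
    here : ∀ {u} → u ≢ x → WalkAvoiding x u u
    step : ∀ {u v w} → u ≢ x → Adj u v → WalkAvoiding x v w → WalkAvoiding x u w

  -- The branch at x through the neighbour y of x consists of x together with
  -- all vertices reachable from y without passing through x; its weight
  -- (number of vertices excluding x) is the size of the latter set.
  BranchWeight : (x y : Fin n) → ℕ → Set
  BranchWeight x y w = Adj x y × (Σ (Subset n) λ S →
                         (∀ v → (v ∈ S) ⇔ WalkAvoiding x y v) × ∣ S ∣ ≡ w)

  -- W_T(x) = w : the maximum weight of a branch at x is w
  -- (convention: 0 if there is no branch, i.e. the one-vertex tree)
  HasBranchWeight : Fin n → ℕ → Set
  HasBranchWeight x w =
      (∀ y w' → BranchWeight x y w' → w' ≤ w)
    × (w ≡ 0 ⊎ ∃ λ y → BranchWeight x y w)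

  IsCentroid : Fin n → Set
  IsCentroid x = Σ ℕ λ w → HasBranchWeight x w
                   × (∀ z w' → HasBranchWeight z w' → w ≤ w')

samePair : ∀ {n} → Fin n → Fin n → Fin n → Fin n → Bool
samePair u v a c = (⌊ u ≟ a ⌋ ∧ ⌊ v ≟ c ⌋) ∨ (⌊ u ≟ c ⌋ ∧ ⌊ v ≟ a ⌋)

moveEdge : ∀ {n} → Graph n → (bb b x : Fin n) → Graph n
moveEdge G bb b x u v = (G u v ∧ not (samePair u v bb b)) ∨ samePair u v x b

module Submission where

-- Call a vertex x of a graph on n vertices *balanced* if every branch at x
-- has weight at most n minus its weight, i.e. at most n/2.  The proof rests
-- on three facts.
-- (1) In a symmetric graph in which every vertex is reachable from x, a
--     balanced x is a centroid: a vertex z ≠ x lies in some branch B at x;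
--     the branch at z leading back to x contains every vertex outside B, so
--     W(z) ≥ n − |B|, while every branch at x is inside B or disjoint from
--     it and hence has weight ≤ n − |B|.
-- (2) In a tree every centroid x is balanced: for a neighbour y of x, the
--     heaviest branch at y either contains x, and then avoids the branch B
--     at x through y, or it is a proper part of B; as W(y) ≥ W(x) ≥ |B|,
--     only the first case is possible, giving |B| ≤ n − |B|.
-- (3) Moving the leaf b to x keeps x balanced: the new branch {b} has weight
--     1 ≤ n − 1, and every other branch at x only loses vertices.
-- Since every vertex stays reachable from x, (1) finishes the proof.
-- Technically, branches are turned into decidable subsets of Fin n by
-- bounding walk lengths with loop erasure, which also turns a walk around
-- an edge into a cycle in (2).

open import Defs
open import Data.Nat using (ℕ; zero; suc; _+_; _∸_; _⊔_; _≤_; z≤n; s≤s)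
import Data.Nat.Properties as ℕP
open import Data.Bool using (true; false; _∧_; _∨_; not; if_then_else_)
import Data.Bool.Properties as BoolP
open import Data.Fin using (Fin; zero; suc; inject₁; fromℕ; _≟_)
import Data.Fin.Properties as FinP
open import Data.Fin.Subset using (Subset; _∈_; _∉_; _⊆_; ∣_∣; ∁; ⁅_⁆)
open import Data.Fin.Subset.Properties
  using (_∈?_; p⊆q⇒∣p∣≤∣q∣; p⊂q⇒∣p∣<∣q∣; ∣∁p∣≡n∸∣p∣; x∉p⇒x∈∁p; x∈∁p⇒x∉p; x∈⁅y⁆⇔x≡y; ∣⁅x⁆∣≡1)
open import Data.Vec using (tabulate)
open import Data.Vec.Properties using ([]=⇒lookup; lookup⇒[]=; lookup∘tabulate)
open import Data.List using (List; []; _∷_; length; lookup; filterᵇ; allFin)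
open import Data.List.Membership.Propositional using () renaming (_∈_ to _∈ˡ_)
open import Data.List.Membership.Propositional.Properties using (∈-lookup; ∈-filter⁺; ∈-allFin)
open import Data.List.Relation.Unary.Any using (here; there; any?)
import Data.List.Relation.Unary.All as All
open import Data.List.Relation.Unary.All.Properties.Core using (¬Any⇒All¬)
open import Data.List.Relation.Unary.AllPairs using ([]; _∷_)
open import Data.List.Relation.Unary.Linked using (Linked; [-]; _∷_)
open import Data.List.Relation.Unary.Unique.Propositional using (Unique)
open import Data.Product using (Σ; ∃; _×_; _,_; proj₁)
open import Data.Sum using (_⊎_; inj₁; inj₂)
open import Data.Empty using (⊥; ⊥-elim)
open import Function using (_∘_)
open import Function.Bundles using (mk⇔; Equivalence)
open import Relation.Binary.Construct.Closure.ReflexiveTransitive using (Star; ε; _◅_; _◅◅_)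
open import Relation.Binary.PropositionalEquality using (_≡_; _≢_; refl; sym; trans; cong; cong₂; subst; ≢-sym)
open import Relation.Nullary using (¬_; Dec; yes; no; does; proof; ¬?)
open import Relation.Nullary.Decidable using (_×-dec_; _⊎-dec_; isYes; isYes≗does; dec-true; dec-false; decidable-stable)
open import Relation.Nullary.Reflects using (Reflects; invert)

shrink-balanced : ∀ {n s t} → s ≤ t → t ≤ n ∸ t → s ≤ n ∸ s
shrink-balanced {n} s≤t t≤n∸t = ℕP.≤-trans s≤t (ℕP.≤-trans t≤n∸t (ℕP.∸-monoʳ-≤ n s≤t))

distinct⇒1≤n∸1 : ∀ {n} (p q : Fin n) → p ≢ q → 1 ≤ n ∸ 1
distinct⇒1≤n∸1 {suc zero} zero zero p≢q = ⊥-elim (p≢q refl)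
distinct⇒1≤n∸1 {suc (suc n)} _ _ _ = s≤s z≤n

maximum : ∀ {m} (f : Fin m → ℕ) → Σ ℕ λ M → (∀ i → f i ≤ M) × (M ≡ 0 ⊎ ∃ λ i → f i ≡ M)
maximum {zero} f = 0 , (λ ()) , inj₁ refl
maximum {suc m} f with maximum (f ∘ suc)
... | M , bounded , attained = f zero ⊔ M , bounded′ , attained′ (ℕP.⊔-sel (f zero) M) attained
  where
    bounded′ : ∀ i → f i ≤ f zero ⊔ M
    bounded′ zero = ℕP.m≤m⊔n (f zero) M
    bounded′ (suc i) = ℕP.≤-trans (bounded i) (ℕP.m≤n⊔m (f zero) M)
    attained′ : f zero ⊔ M ≡ f zero ⊎ f zero ⊔ M ≡ M → M ≡ 0 ⊎ (∃ λ i → f (suc i) ≡ M) →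
                f zero ⊔ M ≡ 0 ⊎ ∃ λ i → f i ≡ f zero ⊔ M
    attained′ (inj₁ max≡f₀) _ = inj₂ (zero , sym max≡f₀)
    attained′ (inj₂ max≡M) (inj₁ M≡0) = inj₁ (trans max≡M M≡0)
    attained′ (inj₂ max≡M) (inj₂ (i , fi≡M)) = inj₂ (suc i , trans fi≡M (sym max≡M))

decided : ∀ {n} {P : Fin n → Set} → (∀ v → Dec (P v)) → Subset n
decided P? = tabulate (λ v → does (P? v))

module _ {n : ℕ} {P : Fin n → Set} (P? : ∀ v → Dec (P v)) where

  decided⁺ : ∀ {v} → P v → v ∈ decided P?
  decided⁺ {v} p = lookup⇒[]= v (decided P?) (trans (lookup∘tabulate _ v) (dec-true (P? v) p))

  decided⁻ : ∀ {v} → v ∈ decided P? → P v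
  decided⁻ {v} v∈ = invert (subst (Reflects (P v)) does≡true (proof (P? v)))
    where
      does≡true : does (P? v) ≡ true
      does≡true = trans (sym (lookup∘tabulate _ v)) ([]=⇒lookup v∈)

same-members⇒same-size : ∀ {n} {S S′ : Subset n} → S ⊆ S′ → S′ ⊆ S → ∣ S ∣ ≡ ∣ S′ ∣
same-members⇒same-size S⊆S′ S′⊆S = ℕP.≤-antisym (p⊆q⇒∣p∣≤∣q∣ S⊆S′) (p⊆q⇒∣p∣≤∣q∣ S′⊆S)

module _ {A : Set} where

  endpoint : A → List A → A
  endpoint a [] = a
  endpoint a (t ∷ ts) = endpoint t ts

  endpoint-lookup : ∀ a l → lookup (a ∷ l) (fromℕ (length l)) ≡ endpoint a l
  endpoint-lookup a [] = refl
  endpoint-lookup a (t ∷ ts) = endpoint-lookup t ts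

  linked-lookup : ∀ {R : A → A → Set} a l → Linked R (a ∷ l) →
                  ∀ (i : Fin (length l)) → R (lookup (a ∷ l) (inject₁ i)) (lookup l i)
  linked-lookup a (t ∷ ts) (r ∷ _) zero = r
  linked-lookup a (t ∷ ts) (_ ∷ linked) (suc i) = linked-lookup t ts linked i

  lookup-injective : ∀ (xs : List A) → Unique xs → ∀ i j → lookup xs i ≡ lookup xs j → i ≡ j
  lookup-injective (x ∷ xs) _ zero zero _ = refl
  lookup-injective (x ∷ xs) (x∉xs ∷ _) zero (suc j) e = ⊥-elim (All.lookup x∉xs (∈-lookup j) e)
  lookup-injective (x ∷ xs) (x∉xs ∷ _) (suc i) zero e = ⊥-elim (All.lookup x∉xs (∈-lookup i) (sym e))
  lookup-injective (x ∷ xs) (_ ∷ distinct) (suc i) (suc j) e = cong suc (lookup-injective xs distinct i j e)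

  member⇒1≤length : ∀ {u} {xs : List A} → u ∈ˡ xs → 1 ≤ length xs
  member⇒1≤length (here _) = s≤s z≤n
  member⇒1≤length (there _) = s≤s z≤n

  two-members⇒2≤length : ∀ {u v} {xs : List A} → u ∈ˡ xs → v ∈ˡ xs → u ≢ v → 2 ≤ length xs
  two-members⇒2≤length (here refl) (here refl) u≢v = ⊥-elim (u≢v refl)
  two-members⇒2≤length (here _) (there v∈) _ = s≤s (member⇒1≤length v∈)
  two-members⇒2≤length (there u∈) (here _) _ = s≤s (member⇒1≤length u∈)
  two-members⇒2≤length (there u∈) (there v∈) u≢v = ℕP.m≤n⇒m≤1+n (two-members⇒2≤length u∈ v∈ u≢v)

unique-length≤ : ∀ {n} (xs : List (Fin n)) → Unique xs → length xs ≤ n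
unique-length≤ {n} xs distinct with length xs ℕP.≤? n
... | yes ≤n = ≤n
... | no ≰n with FinP.pigeonhole (ℕP.≰⇒> ≰n) (lookup xs)
...   | i , j , i<j , same = ⊥-elim (FinP.<⇒≢ i<j (lookup-injective xs distinct i j same))

module LoopErasure {n : ℕ} (R : Fin n → Fin n → Set) where

  Path : Fin n → Fin n → Set
  Path u w = Σ (List (Fin n)) λ ts → Linked R (u ∷ ts) × Unique (u ∷ ts) × endpoint u ts ≡ w

  suffix : ∀ {u v w} ts → u ∈ˡ (v ∷ ts) → Linked R (v ∷ ts) → Unique (v ∷ ts) → endpoint v ts ≡ w → Path u w
  suffix ts (here refl) linked distinct ends = ts , linked , distinct , ends
  suffix (t ∷ ts) (there u∈) (_ ∷ linked) (_ ∷ distinct) ends = suffix ts u∈ linked distinct ends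

  erase : ∀ {u w} → Star R u w → Path u w
  erase ε = [] , [-] , All.[] ∷ [] , refl
  erase {u} (_◅_ {j = v} r walk) with erase walk
  ... | ts , linked , distinct , ends with any? (u ≟_) (v ∷ ts)
  ...   | yes u∈ = suffix ts u∈ linked distinct ends
  ...   | no u∉ = v ∷ ts , r ∷ linked , ¬Any⇒All¬ (v ∷ ts) u∉ ∷ distinct , ends

∧∨false-true : ∀ p q → (p ∧ q) ∨ false ≡ true → p ≡ true × q ≡ true
∧∨false-true true true _ = refl , refl

module _ {n : ℕ} where

  SamePair : Fin n → Fin n → Fin n → Fin n → Set
  SamePair u v a c = (u ≡ a × v ≡ c) ⊎ (u ≡ c × v ≡ a)

  samePair-dec : ∀ u v a c → Dec (SamePair u v a c)
  samePair-dec u v a c = ((u ≟ a) ×-dec (v ≟ c)) ⊎-dec ((u ≟ c) ×-dec (v ≟ a))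

  samePair≡does : ∀ (u v a c : Fin n) → samePair u v a c ≡ does (samePair-dec u v a c)
  samePair≡does u v a c =
    cong₂ _∨_ (cong₂ _∧_ (isYes≗does (u ≟ a)) (isYes≗does (v ≟ c)))
              (cong₂ _∧_ (isYes≗does (u ≟ c)) (isYes≗does (v ≟ a)))

  samePair-true : ∀ {u v a c} → SamePair u v a c → samePair u v a c ≡ true
  samePair-true {u} {v} {a} {c} same = trans (samePair≡does u v a c) (dec-true (samePair-dec u v a c) same)

  samePair-false : ∀ {u v a c} → ¬ SamePair u v a c → samePair u v a c ≡ false
  samePair-false {u} {v} {a} {c} ¬same = trans (samePair≡does u v a c) (dec-false (samePair-dec u v a c) ¬same)

  samePair-without : ∀ {u v a c} → u ≢ c → v ≢ c → samePair u v a c ≡ false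
  samePair-without u≢c v≢c = samePair-false λ { (inj₁ (_ , v≡c)) → v≢c v≡c ; (inj₂ (u≡c , _)) → u≢c u≡c }

  samePair-sym : ∀ (u v a c : Fin n) → samePair u v a c ≡ samePair v u a c
  samePair-sym u v a c =
    trans (BoolP.∨-comm (isYes (u ≟ a) ∧ isYes (v ≟ c)) (isYes (u ≟ c) ∧ isYes (v ≟ a)))
          (cong₂ _∨_ (BoolP.∧-comm (isYes (u ≟ c)) (isYes (v ≟ a))) (BoolP.∧-comm (isYes (u ≟ a)) (isYes (v ≟ c))))

module SymmetricGraph {n : ℕ} (G : Graph n) (G-sym : ∀ u v → G u v ≡ G v u) where

  Avoiding : Fin n → Fin n → Fin n → Set
  Avoiding = WalkAvoiding G

  adj-sym : ∀ {u v} → Adj G u v → Adj G v u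
  adj-sym {u} {v} uv = trans (G-sym v u) uv

  walk-++ : ∀ {u v w} → Walk G u v → Walk G v w → Walk G u w
  walk-++ here q = q
  walk-++ (step a p) q = step a (walk-++ p q)

  start-≢ : ∀ {z u v} → Avoiding z u v → u ≢ z
  start-≢ (here u≢z) = u≢z
  start-≢ (step u≢z _ _) = u≢z

  end-≢ : ∀ {z u v} → Avoiding z u v → v ≢ z
  end-≢ (here v≢z) = v≢z
  end-≢ (step _ _ p) = end-≢ p

  avoid-++ : ∀ {z u v w} → Avoiding z u v → Avoiding z v w → Avoiding z u w
  avoid-++ (here _) q = q
  avoid-++ (step u≢z a p) q = step u≢z a (avoid-++ p q)

  avoid-rev : ∀ {z u v} → Avoiding z u v → Avoiding z v u
  avoid-rev (here v≢z) = here v≢z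
  avoid-rev (step u≢z a p) = avoid-++ (avoid-rev p) (step (start-≢ p) (adj-sym a) (here u≢z))

  avoid⇒walk : ∀ {z u v} → Avoiding z u v → Walk G u v
  avoid⇒walk (here _) = here
  avoid⇒walk (step _ a p) = step a (avoid⇒walk p)

  lastVisit : ∀ {z u t} → Walk G u t → t ≢ z → Avoiding z u t ⊎ ∃ λ z′ → Adj G z z′ × Avoiding z z′ t
  lastVisit here t≢z = inj₁ (here t≢z)
  lastVisit {z} {u} (step {v = v} a p) t≢z with lastVisit p t≢z
  ... | inj₂ afterLast = inj₂ afterLast
  ... | inj₁ vt with u ≟ z
  ...   | yes refl = inj₂ (v , a , vt)
  ...   | no u≢z = inj₁ (step u≢z a vt)

  avoid-or-through : ∀ {x z a v} → Avoiding x a v → Avoiding z a v ⊎ Avoiding x z v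
  avoid-or-through {z = z} {a} p with a ≟ z
  ... | yes refl = inj₂ p
  avoid-or-through (here _) | no a≢z = inj₁ (here a≢z)
  avoid-or-through (step _ e p) | no a≢z with avoid-or-through p
  ... | inj₁ q = inj₁ (step a≢z e q)
  ... | inj₂ q = inj₂ q

  Reach : Fin n → ℕ → Fin n → Fin n → Set
  Reach x zero u v = u ≢ x × u ≡ v
  Reach x (suc k) u v = u ≢ x × (u ≡ v ⊎ ∃ λ w → Adj G u w × Reach x k w v)

  reach? : ∀ x k u v → Dec (Reach x k u v)
  reach? x zero u v = ¬? (u ≟ x) ×-dec (u ≟ v)
  reach? x (suc k) u v =
    ¬? (u ≟ x) ×-dec ((u ≟ v) ⊎-dec FinP.any? (λ w → (G u w BoolP.≟ true) ×-dec reach? x k w v))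

  reach-sound : ∀ {x} k {u v} → Reach x k u v → Avoiding x u v
  reach-sound zero (u≢x , refl) = here u≢x
  reach-sound (suc k) (u≢x , inj₁ refl) = here u≢x
  reach-sound (suc k) (u≢x , inj₂ (w , a , r)) = step u≢x a (reach-sound k r)

  reach-suc : ∀ {x} k {u v} → Reach x k u v → Reach x (suc k) u v
  reach-suc zero (u≢x , u≡v) = u≢x , inj₁ u≡v
  reach-suc (suc k) (u≢x , inj₁ u≡v) = u≢x , inj₁ u≡v
  reach-suc (suc k) (u≢x , inj₂ (w , a , r)) = u≢x , inj₂ (w , a , reach-suc k r)

  reach-≤ : ∀ {x k m u v} → k ≤ m → Reach x k u v → Reach x m u v
  reach-≤ {x} {k} {m} {u} {v} k≤m r = subst (λ l → Reach x l u v) (ℕP.m∸n+n≡m k≤m) (lift (m ∸ k))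
    where
      lift : ∀ d → Reach x (d + k) u v
      lift zero = r
      lift (suc d) = reach-suc (d + k) (lift d)

  StepAvoiding : Fin n → Fin n → Fin n → Set
  StepAvoiding x a c = Adj G a c × c ≢ x

  avoid⇒star : ∀ {x u v} → Avoiding x u v → Star (StepAvoiding x) u v
  avoid⇒star (here _) = ε
  avoid⇒star (step _ a p) = (a , start-≢ p) ◅ avoid⇒star p

  path⇒reach : ∀ {x u} ts → u ≢ x → Linked (StepAvoiding x) (u ∷ ts) → Reach x (length ts) u (endpoint u ts)
  path⇒reach [] u≢x _ = u≢x , refl
  path⇒reach (t ∷ ts) u≢x ((a , t≢x) ∷ linked) = u≢x , inj₂ (t , a , path⇒reach ts t≢x linked)

  reach-complete : ∀ {x u v} → Avoiding x u v → Reach x n u v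
  reach-complete {x} {u} p with LoopErasure.erase (StepAvoiding x) (avoid⇒star p)
  ... | ts , linked , distinct , refl =
    reach-≤ (ℕP.≤-trans (ℕP.n≤1+n _) (unique-length≤ (u ∷ ts) distinct)) (path⇒reach ts (start-≢ p) linked)

  branch : Fin n → Fin n → Subset n
  branch x y = decided (reach? x n y)

  branch⁺ : ∀ {x y v} → Avoiding x y v → v ∈ branch x y
  branch⁺ {x} {y} p = decided⁺ (reach? x n y) (reach-complete p)

  branch⁻ : ∀ {x y v} → v ∈ branch x y → Avoiding x y v
  branch⁻ {x} {y} v∈ = reach-sound n (decided⁻ (reach? x n y) v∈)

  branchWeight : ∀ {x y} → Adj G x y → BranchWeight G x y ∣ branch x y ∣
  branchWeight {x} {y} xy = xy , branch x y , (λ v → mk⇔ branch⁻ branch⁺) , refl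

  branchWeight-unique : ∀ {x y w} → BranchWeight G x y w → w ≡ ∣ branch x y ∣
  branchWeight-unique (_ , S , members , refl) =
    same-members⇒same-size (branch⁺ ∘ Equivalence.to (members _)) (Equivalence.from (members _) ∘ branch⁻)

  weightTowards : Fin n → Fin n → ℕ
  weightTowards x y = if G x y then ∣ branch x y ∣ else 0

  hasBranchWeight : ∀ x → ∃ λ w → HasBranchWeight G x w
  hasBranchWeight x with maximum (weightTowards x)
  ... | M , bounded , attained = M , upper , attained′ attained
    where
      upper : ∀ y w → BranchWeight G x y w → w ≤ M
      upper y w bw@(xy , _) rewrite branchWeight-unique bw =
        subst (_≤ M) (cong (λ c → if c then ∣ branch x y ∣ else 0) xy) (bounded y)
      attained′ : (M ≡ 0 ⊎ ∃ λ y → weightTowards x y ≡ M) → M ≡ 0 ⊎ ∃ λ y → BranchWeight G x y M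
      attained′ (inj₁ M≡0) = inj₁ M≡0
      attained′ (inj₂ (y , weight≡M)) with G x y in xy
      ... | true = inj₂ (y , subst (BranchWeight G x y) weight≡M (branchWeight xy))
      ... | false = inj₁ (sym weight≡M)

  branchWeight-≤ : ∀ {x w w′} → HasBranchWeight G x w → HasBranchWeight G x w′ → w ≤ w′
  branchWeight-≤ (_ , inj₁ refl) _ = z≤n
  branchWeight-≤ (_ , inj₂ (y , bw)) (upper , _) = upper y _ bw

  branch-nested : ∀ {x y y₁} → y ∈ branch x y₁ → branch x y ⊆ branch x y₁
  branch-nested y∈ v∈ = branch⁺ (avoid-++ (branch⁻ y∈) (branch⁻ v∈))

  branch-disjoint : ∀ {x y y₁} → y ∉ branch x y₁ → branch x y ⊆ ∁ (branch x y₁)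
  branch-disjoint y∉ v∈ = x∉p⇒x∈∁p (λ v∈₁ → y∉ (branch⁺ (avoid-++ (branch⁻ v∈₁) (avoid-rev (branch⁻ v∈)))))

  Balanced : Fin n → Set
  Balanced x = ∀ {y} → Adj G x y → ∣ branch x y ∣ ≤ n ∸ ∣ branch x y ∣

  weight-≤-complement : ∀ {x y₁ w} → Balanced x → Adj G x y₁ → HasBranchWeight G x w →
                        w ≤ n ∸ ∣ branch x y₁ ∣
  weight-≤-complement _ _ (_ , inj₁ refl) = z≤n
  weight-≤-complement {x} {y₁} balanced xy₁ (_ , inj₂ (y , bw)) rewrite branchWeight-unique bw
    with y ∈? branch x y₁
  ... | yes y∈ = ℕP.≤-trans (p⊆q⇒∣p∣≤∣q∣ (branch-nested y∈)) (balanced xy₁)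
  ... | no y∉ = subst (∣ branch x y ∣ ≤_) (∣∁p∣≡n∸∣p∣ (branch x y₁)) (p⊆q⇒∣p∣≤∣q∣ (branch-disjoint y∉))

  complement-⊆ : ∀ {x y z z′} → (∀ v → Walk G x v) → Adj G x y → Avoiding x y z → Avoiding z z′ x →
                 ∁ (branch x y) ⊆ branch z z′
  complement-⊆ {x} {y} {z} reach xy yz z′x {v} v∉ with v ≟ x
  ... | yes refl = branch⁺ z′x
  ... | no v≢x with lastVisit (reach v) v≢x
  ...   | inj₁ xv = ⊥-elim (start-≢ xv refl)
  ...   | inj₂ (y₂ , xy₂ , y₂v) with avoid-or-through {z = z} y₂v
  ...     | inj₁ y₂v′ = branch⁺ (avoid-++ z′x (step (≢-sym (end-≢ yz)) xy₂ y₂v′))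
  ...     | inj₂ zv = ⊥-elim (x∈∁p⇒x∉p v∉ (branch⁺ (avoid-++ yz zv)))

  weight-beyond : ∀ {x y z w} → (∀ v → Walk G x v) → Adj G x y → Avoiding x y z → HasBranchWeight G z w →
                  n ∸ ∣ branch x y ∣ ≤ w
  weight-beyond {x} {y} {z} {w} reach xy yz (upper , _)
    with lastVisit {z = z} (walk-++ (avoid⇒walk (avoid-rev yz)) (step (adj-sym xy) here)) (≢-sym (end-≢ yz))
  ... | inj₁ zx = ⊥-elim (start-≢ zx refl)
  ... | inj₂ (z′ , zz′ , z′x) = begin
    n ∸ ∣ branch x y ∣   ≡⟨ sym (∣∁p∣≡n∸∣p∣ (branch x y)) ⟩
    ∣ ∁ (branch x y) ∣   ≤⟨ p⊆q⇒∣p∣≤∣q∣ (complement-⊆ reach xy yz z′x) ⟩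
    ∣ branch z z′ ∣      ≤⟨ upper z′ _ (branchWeight zz′) ⟩
    w                    ∎
    where open ℕP.≤-Reasoning

  balanced⇒centroid : ∀ {x} → (∀ v → Walk G x v) → Balanced x → IsCentroid G x
  balanced⇒centroid {x} reach balanced with hasBranchWeight x
  ... | w , hx = w , hx , minimal
    where
      minimal : ∀ z w′ → HasBranchWeight G z w′ → w ≤ w′
      minimal z w′ hz with z ≟ x
      ... | yes refl = branchWeight-≤ hx hz
      ... | no z≢x with lastVisit (reach z) z≢x
      ...   | inj₁ xz = ⊥-elim (start-≢ xz refl)
      ...   | inj₂ (y₁ , xy₁ , y₁z) =
        ℕP.≤-trans (weight-≤-complement balanced xy₁ hx) (weight-beyond reach xy₁ y₁z hz)

module Forest {n : ℕ} (G : Graph n) (G-sym : ∀ u v → G u v ≡ G v u) (G-loop : ∀ u → G u u ≡ false)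
              (acyclic : Acyclic G) where
  open SymmetricGraph G G-sym

  adj⇒≢ : ∀ {u v} → Adj G u v → u ≢ v
  adj⇒≢ {u} uv refl with trans (sym uv) (G-loop u)
  ... | ()

  -- The two sides of an edge xy are disjoint: no vertex is reachable both
  -- from x avoiding y and from y avoiding x, since the two walks followed by
  -- the edge would contain a cycle.
  edge-separates : ∀ {x y v} → Adj G x y → Avoiding y x v → Avoiding x y v → ⊥
  edge-separates {x} {y} xy xv yv = no-path (erase (forward xv ◅◅ forward′ (avoid-rev yv)))
    where
      OtherStep : Fin n → Fin n → Set
      OtherStep a c = Adj G a c × (a ≡ x → c ≢ y)
      open LoopErasure OtherStep

      forward : ∀ {a w} → Avoiding y a w → Star OtherStep a w
      forward (here _) = ε
      forward (step _ e p) = (e , λ _ → start-≢ p) ◅ forward p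

      forward′ : ∀ {a w} → Avoiding x a w → Star OtherStep a w
      forward′ (here _) = ε
      forward′ (step a≢x e p) = (e , λ a≡x → ⊥-elim (a≢x a≡x)) ◅ forward′ p

      no-path : Path x y → ⊥
      no-path ([] , _ , _ , x≡y) = adj⇒≢ xy x≡y
      no-path (t ∷ [] , ((_ , not-xy) ∷ [-]) , _ , t≡y) = not-xy refl t≡y
      no-path (t₁ ∷ t₂ ∷ ts , linked , distinct , ends) =
        acyclic (length ts , lookup xs , (λ {i} {j} → lookup-injective xs distinct i j) ,
                 (λ i → proj₁ (linked-lookup x (t₁ ∷ t₂ ∷ ts) linked i)) ,
                 subst (λ q → Adj G q x) (sym (trans (endpoint-lookup x (t₁ ∷ t₂ ∷ ts)) ends)) (adj-sym xy))
        where xs = x ∷ t₁ ∷ t₂ ∷ ts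

  centroid⇒balanced : ∀ {x} → IsCentroid G x → Balanced x
  centroid⇒balanced {x} (w , (upper , _) , minimal) {y} xy with hasBranchWeight y
  ... | wy , hy@(_ , attained) = heaviest-at-y attained
    where
      B≤wy : ∣ branch x y ∣ ≤ wy
      B≤wy = ℕP.≤-trans (upper y _ (branchWeight xy)) (minimal y wy hy)

      y≢x : y ≢ x
      y≢x = ≢-sym (adj⇒≢ xy)

      outside : ∀ {u} → x ∈ branch y u → branch y u ⊆ ∁ (branch x y)
      outside x∈ v∈ = x∉p⇒x∈∁p (λ v∈B →
        edge-separates xy (avoid-++ (avoid-rev (branch⁻ x∈)) (branch⁻ v∈)) (branch⁻ v∈B))

      inside : ∀ {u} → Adj G y u → x ∉ branch y u → (branch y u ⊆ branch x y) × ∃ λ v → v ∈ branch x y × v ∉ branch y u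
      inside {u} yu x∉ = ⊆B , y , branch⁺ (here y≢x) , λ y∈ → end-≢ (branch⁻ y∈) refl
        where
          ⊆B : branch y u ⊆ branch x y
          ⊆B v∈ with avoid-or-through {z = x} (branch⁻ v∈)
          ... | inj₁ uv = branch⁺ (step y≢x yu uv)
          ... | inj₂ xv = ⊥-elim (x∉ (branch⁺ (avoid-++ (branch⁻ v∈) (avoid-rev xv))))

      heaviest-at-y : (wy ≡ 0 ⊎ ∃ λ u → BranchWeight G y u wy) → ∣ branch x y ∣ ≤ n ∸ ∣ branch x y ∣
      heaviest-at-y (inj₁ refl) = ℕP.≤-trans B≤wy z≤n
      heaviest-at-y (inj₂ (u , yu)) with x ∈? branch y u
      ... | yes x∈ = begin
        ∣ branch x y ∣       ≤⟨ B≤wy ⟩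
        wy                   ≡⟨ branchWeight-unique yu ⟩
        ∣ branch y u ∣       ≤⟨ p⊆q⇒∣p∣≤∣q∣ (outside x∈) ⟩
        ∣ ∁ (branch x y) ∣   ≡⟨ ∣∁p∣≡n∸∣p∣ (branch x y) ⟩
        n ∸ ∣ branch x y ∣   ∎
        where open ℕP.≤-Reasoning
      ... | no x∉ = ⊥-elim (ℕP.<⇒≱ (p⊂q⇒∣p∣<∣q∣ (inside (proj₁ yu) x∉))
                                    (ℕP.≤-trans B≤wy (ℕP.≤-reflexive (branchWeight-unique yu))))

module LeafMove {n : ℕ} (G : Graph n) (G-sym : ∀ u v → G u v ≡ G v u)
                (x b bb : Fin n) (leaf : IsLeaf G b) (b-bb : Adj G b bb) (x≢b : x ≢ b) where

  G′ : Graph n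
  G′ = moveEdge G bb b x

  G′-sym : ∀ u v → G′ u v ≡ G′ v u
  G′-sym u v = cong₂ _∨_ (cong₂ _∧_ (G-sym u v) (cong not (samePair-sym u v bb b))) (samePair-sym u v x b)

  module Old = SymmetricGraph G G-sym
  module New = SymmetricGraph G′ G′-sym

  neighbour∈ : ∀ {u} → Adj G b u → u ∈ˡ filterᵇ (G b) (allFin n)
  neighbour∈ {u} b-u = ∈-filter⁺ _ (∈-allFin u) (Equivalence.from BoolP.T-≡ b-u)

  leaf-neighbour : ∀ {v} → Adj G b v → v ≡ bb
  leaf-neighbour {v} b-v with v ≟ bb
  ... | yes v≡bb = v≡bb
  ... | no v≢bb with two-members⇒2≤length (neighbour∈ b-v) (neighbour∈ b-bb) v≢bb
  ...   | 2≤degree rewrite leaf with 2≤degree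
  ...     | s≤s ()

  G′-away : ∀ {u v} → u ≢ b → v ≢ b → G′ u v ≡ G u v
  G′-away {u} {v} u≢b v≢b
    rewrite samePair-without {a = bb} u≢b v≢b | samePair-without {a = x} u≢b v≢b
    = trans (BoolP.∨-identityʳ _) (BoolP.∧-identityʳ (G u v))

  G′-x-b : Adj G′ x b
  G′-x-b rewrite samePair-true {u = x} {b} {x} {b} (inj₁ (refl , refl)) = BoolP.∨-zeroʳ _

  not-new-edge : ∀ {v} → v ≢ x → samePair b v x b ≡ false
  not-new-edge v≢x = samePair-false λ { (inj₁ (b≡x , _)) → x≢b (sym b≡x) ; (inj₂ (_ , v≡x)) → v≢x v≡x }

  old-edge-removed : ∀ {v} → v ≢ x → ¬ Adj G′ b v
  old-edge-removed {v} v≢x b-v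
    with ∧∨false-true (G b v) _ (subst (λ s → (G b v ∧ not (samePair b v bb b)) ∨ s ≡ true) (not-new-edge v≢x) b-v)
  ... | b-v-old , not-moved
    with trans (sym (cong not (samePair-true {u = b} {v} {bb} {b} (inj₂ (refl , leaf-neighbour b-v-old))))) not-moved
  ... | ()

  G′-b-only-x : ∀ {v} → Adj G′ b v → v ≡ x
  G′-b-only-x {v} b-v = decidable-stable (v ≟ x) (λ v≢x → old-edge-removed v≢x b-v)

  avoid-leaf : ∀ {u t} → Walk G u t → u ≢ b → t ≢ b → Old.Avoiding b u t
  avoid-leaf here u≢b _ = here u≢b
  avoid-leaf (step {v = w} a p) u≢b t≢b with w ≟ b
  ... | no w≢b = step u≢b a (avoid-leaf p w≢b t≢b)
  avoid-leaf (step a here) u≢b t≢b | yes refl = ⊥-elim (t≢b refl)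
  avoid-leaf (step a (step a′ p)) u≢b t≢b | yes refl
    with trans (leaf-neighbour (Old.adj-sym a)) (sym (leaf-neighbour a′))
  ... | refl = avoid-leaf p u≢b t≢b

  avoid-leaf⇒walk′ : ∀ {u t} → Old.Avoiding b u t → Walk G′ u t
  avoid-leaf⇒walk′ (here _) = here
  avoid-leaf⇒walk′ (step u≢b a p) = step (trans (G′-away u≢b (Old.start-≢ p)) a) (avoid-leaf⇒walk′ p)

  reachable′ : Connected G → ∀ v → Walk G′ x v
  reachable′ connected v with v ≟ b
  ... | yes refl = step G′-x-b here
  ... | no v≢b = avoid-leaf⇒walk′ (avoid-leaf (connected x v) x≢b v≢b)

  -- A G′-walk avoiding x and not starting at b never reaches b (whose only
  -- G′-neighbour is x), so it is a G-walk.
  avoid′⇒avoid : ∀ {u v} → New.Avoiding x u v → u ≢ b → Old.Avoiding x u v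
  avoid′⇒avoid (here u≢x) _ = here u≢x
  avoid′⇒avoid (step {v = w} u≢x a p) u≢b = step u≢x (trans (sym (G′-away u≢b w≢b)) a) (avoid′⇒avoid p w≢b)
    where
      w≢b : w ≢ b
      w≢b refl = u≢x (G′-b-only-x (New.adj-sym a))

  -- The new branch at x is {b}, of weight 1 ≤ n − 1.
  new-branch-balanced : ∣ New.branch x b ∣ ≤ n ∸ ∣ New.branch x b ∣
  new-branch-balanced =
    shrink-balanced (ℕP.≤-trans (p⊆q⇒∣p∣≤∣q∣ only-b) (ℕP.≤-reflexive (∣⁅x⁆∣≡1 b))) (distinct⇒1≤n∸1 x b x≢b)
    where
      only-b : New.branch x b ⊆ ⁅ b ⁆
      only-b v∈ with New.branch⁻ v∈
      ... | here _ = Equivalence.from x∈⁅y⁆⇔x≡y refl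
      ... | step _ b-w rest = ⊥-elim (New.start-≢ rest (G′-b-only-x b-w))

  old-branch-shrinks : ∀ {y} → y ≢ b → New.branch x y ⊆ Old.branch x y
  old-branch-shrinks y≢b v∈ = Old.branch⁺ (avoid′⇒avoid (New.branch⁻ v∈) y≢b)

  balanced′ : Old.Balanced x → New.Balanced x
  balanced′ balanced {y} x-y = by-cases (y ≟ b)
    where
      by-cases : Dec (y ≡ b) → ∣ New.branch x y ∣ ≤ n ∸ ∣ New.branch x y ∣
      by-cases (yes y≡b) = subst (λ c → ∣ New.branch x c ∣ ≤ n ∸ ∣ New.branch x c ∣) (sym y≡b) new-branch-balanced
      by-cases (no y≢b) = shrink-balanced (p⊆q⇒∣p∣≤∣q∣ (old-branch-shrinks y≢b))
                                          (balanced (trans (sym (G′-away x≢b y≢b)) x-y))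

proposition2 : ∀ {n : ℕ} (G : Graph n) (x b bb : Fin n) →
    IsTree G → IsCentroid G x → IsLeaf G b → Adj G b bb → x ≢ b →
    IsCentroid (moveEdge G bb b x) x
proposition2 G x b bb ((G-sym , G-loop) , connected , acyclic) centroid leaf b-bb x≢b =
  New.balanced⇒centroid (reachable′ connected) (balanced′ (Forest.centroid⇒balanced G G-sym G-loop acyclic centroid))
  where open LeafMove G G-sym x b bb leaf b-bb x≢b
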